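{- For a subset $W$ of $\mathcal{W}_n$, the following are equivalent: (i) $W$ is the vertex set of a D$_0$ graph; (ii) for every KR square $X$ of $\mathcal{W}_n$, the set $W\cap X$ is empty, is all of $X$, or consists of two words which differ by a Knuth transformation or a rotation transformation; (iii) $\sum_{w\in W}w\in(I_{\mathrm{KR}}^{\mathrm{st}})^\perp$. (Such $W$ is called a KR set.)
   Context: $\mathcal{U}=\mathbb{Z}\langle u_1,\dots,u_N\rangle$, monomials identified with words in $\{1,\dots,N\}$; $\mathcal{W}_n$ is the set of words of length $n$ with no repeated letter. $I_{\mathrm{KR}}^{\mathrm{st}}$ is the two-sided ideal generated by $b(ac-ca)-(ac-ca)b$ for letters $a<b<c$ and by all words with a repeated letter. $\langle\cdot,\cdot\rangle$ is the symmetric bilinear form on $\mathcal{U}$ for which words are orthonormal, and $I^\perp=\{f\in\mathcal{U}:\langle z,f\rangle=0\ \forall z\in I\}$. A KR square is a 4-tuple $(v\,bac\,w,\ v\,bca\,w,\ v\,acb\,w,\ v\,cab\,w)$ of words with no repeated letter, for letters $a<b<c$ and words $v,w$ (a KR$_i$ square if $v$ has length $i-2$); it is a KR square of $\mathcal{W}_n$ if its entries lie in $\mathcal{W}_n$. A Knuth transformation exchanges $v\,bac\,w\leftrightarrow v\,bca\,w$ or $v\,acb\,w\leftrightarrow v\,cab\,w$; a rotation transformation exchanges $v\,bac\,w\leftrightarrow v\,acb\,w$ or $v\,bca\,w\leftrightarrow v\,cab\,w$. A D$_0$ graph of degree $n$ is a graph on $W\subseteq\mathcal{W}_n$ with edges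 colored from $\{2,\dots,n-1\}$ such that each $i$-edge is a pair $\{x,y\}$ where $x\to y$ is a Knuth or rotation transformation within a KR$_i$ square, and for every KR$_i$ square $X$ each element of $W\cap X$ belongs to exactly one $i$-edge. -}

module Defs where

open import Level using (Level; 0ℓ) renaming (suc to lsuc)
open import Data.Nat using (ℕ; _≤_; _∸_)
open import Data.Fin using (Fin; _<_)
open import Data.Integer using (ℤ; +_; -[1+_]) renaming (_*_ to _*ℤ_; _+_ to _+ℤ_)
open import Data.Bool using (Bool; true; false; if_then_else_)
open import Data.List using (List; []; _∷_; _++_; length; map; [_])
open import Data.List.Membership.Propositional using (_∈_)
open import Data.List.Relation.Unary.Unique.Propositional using (Unique)
open import Data.Product using (Σ; _×_; _,_; ∃; ∃-syntax)
open import Data.Sum using (_⊎_)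
open import Relation.Nullary using (¬_)
open import Relation.Binary.PropositionalEquality using (_≡_)

-- Words in the letters {1,…,N}, modelled as Fin N (order-preserving relabelling)

Word : ℕ → Set
Word N = List (Fin N)

InW : {N : ℕ} → ℕ → Word N → Set
InW n w = length w ≡ n × Unique w

record KRSquare (N : ℕ) : Set where
  field
    v w   : Word N
    a b c : Fin N
    a<b   : a < b
    b<c   : b < c
    u₁ : Unique (v ++ b ∷ a ∷ c ∷ w)
    u₂ : Unique (v ++ b ∷ c ∷ a ∷ w)
    u₃ : Unique (v ++ a ∷ c ∷ b ∷ w)
    u₄ : Unique (v ++ c ∷ a ∷ b ∷ w)
  e₁ e₂ e₃ e₄ : Word N
  e₁ = v ++ b ∷ a ∷ c ∷ w
  e₂ = v ++ b ∷ c ∷ a ∷ w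
  e₃ = v ++ a ∷ c ∷ b ∷ w
  e₄ = v ++ c ∷ a ∷ b ∷ w
  entries : List (Word N)
  entries = e₁ ∷ e₂ ∷ e₃ ∷ e₄ ∷ []

open KRSquare public

IsKR : {N : ℕ} → ℕ → KRSquare N → Set
IsKR i X = length (v X) ≡ i ∸ 2

KRof : {N : ℕ} → ℕ → KRSquare N → Set
KRof n X = (x : _) → x ∈ entries X → InW n x

data Knuth {N : ℕ} : Word N → Word N → Set where
  k₁ : ∀ v w {a b c : Fin N} → a < b → b < c →
       Knuth (v ++ b ∷ a ∷ c ∷ w) (v ++ b ∷ c ∷ a ∷ w)
  k₂ : ∀ v w {a b c : Fin N} → a < b → b < c →
       Knuth (v ++ b ∷ c ∷ a ∷ w) (v ++ b ∷ a ∷ c ∷ w)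
  k₃ : ∀ v w {a b c : Fin N} → a < b → b < c →
       Knuth (v ++ a ∷ c ∷ b ∷ w) (v ++ c ∷ a ∷ b ∷ w)
  k₄ : ∀ v w {a b c : Fin N} → a < b → b < c →
       Knuth (v ++ c ∷ a ∷ b ∷ w) (v ++ a ∷ c ∷ b ∷ w)

data Rotation {N : ℕ} : Word N → Word N → Set where
  r₁ : ∀ v w {a b c : Fin N} → a < b → b < c →
       Rotation (v ++ b ∷ a ∷ c ∷ w) (v ++ a ∷ c ∷ b ∷ w)
  r₂ : ∀ v w {a b c : Fin N} → a < b → b < c →
       Rotation (v ++ a ∷ c ∷ b ∷ w) (v ++ b ∷ a ∷ c ∷ w)
  r₃ : ∀ v w {a b c : Fin N} → a < b → b < c →
       Rotation (v ++ b ∷ c ∷ a ∷ w) (v ++ c ∷ a ∷ b ∷ w)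
  r₄ : ∀ v w {a b c : Fin N} → a < b → b < c →
       Rotation (v ++ c ∷ a ∷ b ∷ w) (v ++ b ∷ c ∷ a ∷ w)

Subset : ℕ → Set
Subset N = Word N → Bool

_⊆W_ : {N : ℕ} → Subset N → ℕ → Set
W ⊆W n = ∀ x → W x ≡ true → InW n x

-- (i) D₀ graphs.  An edge-coloured graph on vertex set W is given by a
-- relation E i x y ("{x,y} is an i-edge"), required to be symmetric.

record IsD0Graph {N : ℕ} (n : ℕ) (W : Subset N)
                 (E : ℕ → Word N → Word N → Set) : Set where
  field
    symmetric : ∀ i x y → E i x y → E i y x
    onW       : ∀ i x y → E i x y → W x ≡ true × W y ≡ true
    colours   : ∀ i x y → E i x y → 2 ≤ i × i ≤ n ∸ 1
    edgeKR    : ∀ i x y → E i x y →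
                Σ (KRSquare N) λ X → IsKR i X × x ∈ entries X × y ∈ entries X
                  × (Knuth x y ⊎ Rotation x y)
    perfect   : ∀ i → 2 ≤ i → i ≤ n ∸ 1 → (X : KRSquare N) → IsKR i X →
                ∀ x → x ∈ entries X → W x ≡ true →
                Σ (Word N) λ y → E i x y × (∀ y′ → E i x y′ → y′ ≡ y)

D0VertexSet : {N : ℕ} → ℕ → Subset N → Set₁
D0VertexSet {N} n W = Σ (ℕ → Word N → Word N → Set) λ E → IsD0Graph n W E

LocalKR : {N : ℕ} → ℕ → Subset N → Set
LocalKR {N} n W = (X : KRSquare N) → KRof n X →
    (∀ z → z ∈ entries X → W z ≡ false)
  ⊎ (∀ z → z ∈ entries X → W z ≡ true)
  ⊎ (Σ (Word N) λ x → Σ (Word N) λ y →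
       x ∈ entries X × y ∈ entries X × ¬ (x ≡ y)
       × (∀ z → z ∈ entries X → (W z ≡ true → z ≡ x ⊎ z ≡ y)
                              × (z ≡ x ⊎ z ≡ y → W z ≡ true))
       × (Knuth x y ⊎ Rotation x y))

-- (iii) the orthogonality condition.
-- Elements of 𝒰 = ℤ⟨u₁,…,u_N⟩ are represented by formal ℤ-linear
-- combinations of words (lists of coefficient/word pairs).

Poly : ℕ → Set
Poly N = List (ℤ × Word N)

lmulP : {N : ℕ} → Word N → Poly N → Poly N
lmulP u = map (λ { (k , x) → (k , u ++ x) })

rmulP : {N : ℕ} → Poly N → Word N → Poly N
rmulP p u = map (λ { (k , x) → (k , x ++ u) }) p

scaleP : {N : ℕ} → ℤ → Poly N → Poly N
scaleP m = map (λ { (k , x) → (m *ℤ k , x) })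

-- b(ac − ca) − (ac − ca)b = bac − bca − acb + cab
krGen : {N : ℕ} → Fin N → Fin N → Fin N → Poly N
krGen a b c =
  (+ 1 , b ∷ a ∷ c ∷ []) ∷ (-[1+ 0 ] , b ∷ c ∷ a ∷ []) ∷
  (-[1+ 0 ] , a ∷ c ∷ b ∷ []) ∷ (+ 1 , c ∷ a ∷ b ∷ []) ∷ []

data InIKR {N : ℕ} : Poly N → Set where
  genKR  : ∀ {a b c : Fin N} → a < b → b < c → InIKR (krGen a b c)
  genRep : ∀ (x : Word N) → ¬ Unique x → InIKR [ (+ 1 , x) ]
  zeroI  : InIKR []
  addI   : ∀ {p q} → InIKR p → InIKR q → InIKR (p ++ q)
  scaleI : ∀ m {p} → InIKR p → InIKR (scaleP m p)
  lmulI  : ∀ u {p} → InIKR p → InIKR (lmulP u p)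
  rmulI  : ∀ u {p} → InIKR p → InIKR (rmulP p u)

-- ⟨ z , Σ_{w∈W} w ⟩ for z given as a formal combination
pairW : {N : ℕ} → Subset N → Poly N → ℤ
pairW W [] = + 0
pairW W ((k , x) ∷ p) = (if W x then k else + 0) +ℤ pairW W p

InPerp : {N : ℕ} → Subset N → Set
InPerp {N} W = (z : Poly N) → InIKR z → pairW W z ≡ + 0

-- Everything happens inside single KR squares. The four words of a square form a 4-cycle
-- bac – bca – cab – acb – bac whose edges are the Knuth and the rotation transformations, and the
-- words lying in W form a pattern on this cycle; call it admissible if it is empty, everything,
-- or an edge, which is what (ii) demands of every square. A D₀ graph restricted to a square is
-- a perfect matching of the pattern along the cycle, and the patterns having such a matching are
-- exactly the admissible ones. Pairing Σ_W with v·(b(ac − ca) − (ac − ca)b)·w gives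
-- [bac] − [bca] − [acb] + [cab], which vanishes exactly on admissible patterns; since the ideal
-- is spanned by two-sided multiples of these generators and of words with a repeated letter, which
-- W avoids, this is (iii). A word and the length of v determine the square and the position,
-- the latter through the relative order of the three letters a < b < c.

module Submission where

open import Defs
open import Data.Nat as ℕ using (ℕ; suc; _+_; _∸_; s≤s; z≤n)
import Data.Nat.Properties as ℕP
open import Data.Fin as F using (Fin)
import Data.Fin.Properties as FP
open import Data.Integer using (ℤ; +_; -[1+_]) renaming (_*_ to _*ℤ_; _+_ to _+ℤ_)
import Data.Integer.Properties as ℤP
open import Data.Bool using (Bool; true; false; if_then_else_)
open import Data.Bool.Properties using (⇔→≡; not-¬)
open import Data.List using (List; []; _∷_; _++_; length)
import Data.List.Properties as LP
open import Data.List.Membership.Propositional using (_∈_)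
open import Data.List.Relation.Unary.Any using (here; there)
import Data.List.Relation.Unary.All.Properties as AllP
open import Data.List.Relation.Unary.AllPairs using ([]; _∷_)
open import Data.List.Relation.Unary.Unique.Propositional using (Unique)
open import Data.List.Relation.Binary.Permutation.Propositional as ↭ using (_↭_; prep; swap; ↭⇒↭ₛ)
import Data.List.Relation.Binary.Permutation.Propositional.Properties as ↭P
import Data.List.Relation.Binary.Permutation.Setoid.Properties as PermS
open import Data.Product using (Σ; ∃; _×_; _,_; proj₁; proj₂)
open import Data.Sum using (_⊎_; inj₁; inj₂)
import Data.Sum
open import Data.Empty using (⊥; ⊥-elim)
open import Function using (_∘_)
open import Function.Bundles using (_⇔_; mk⇔; Equivalence)
import Function.Properties.Equivalence as ⇔
open import Relation.Nullary using (¬_; Dec; yes; no; does)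
open import Relation.Nullary.Decidable using (dec-true; dec-false; map′; _⊎-dec_)
open import Relation.Binary.PropositionalEquality
  using (_≡_; _≢_; refl; sym; trans; cong; cong₂; subst; _≗_; setoid)

does≡true⇔ : ∀ {A : Set} (a? : Dec A) → does a? ≡ true ⇔ A
does≡true⇔ (yes a) = mk⇔ (λ _ → a) (λ _ → refl)
does≡true⇔ (no ¬a) = mk⇔ (λ ()) (⊥-elim ∘ ¬a)

++-injective : ∀ {A : Set} (xs xs′ : List A) {ys ys′} → length xs ≡ length xs′ →
               xs ++ ys ≡ xs′ ++ ys′ → xs ≡ xs′ × ys ≡ ys′
++-injective []       []         _ eq = refl , eq
++-injective (x ∷ xs) (x′ ∷ xs′) |xs|≡ eq with LP.∷-injective eq
... | refl , eq′ with ++-injective xs xs′ (ℕP.suc-injective |xs|≡) eq′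
... | refl , eq″ = refl , eq″

unique-++⁻ˡ : ∀ {A : Set} (xs : List A) {ys} → Unique (xs ++ ys) → Unique xs
unique-++⁻ˡ []       _         = []
unique-++⁻ˡ (x ∷ xs) (x∉ ∷ xs!) = AllP.++⁻ˡ xs x∉ ∷ unique-++⁻ˡ xs xs!

unique-++⁻ʳ : ∀ {A : Set} (xs : List A) {ys} → Unique (xs ++ ys) → Unique ys
unique-++⁻ʳ []       ys!       = ys!
unique-++⁻ʳ (x ∷ xs) (_ ∷ xs!) = unique-++⁻ʳ xs xs!

-- The square graph

-- p₁, p₂, p₃, p₄ stand for v bac w, v bca w, v acb w, v cab w, the order of `entries`.
data Pos : Set where
  p₁ p₂ p₃ p₄ : Pos

variable
  j k m : Pos

knuthMate rotationMate opposite : Pos → Pos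
knuthMate p₁ = p₂
knuthMate p₂ = p₁
knuthMate p₃ = p₄
knuthMate p₄ = p₃
rotationMate p₁ = p₃
rotationMate p₂ = p₄
rotationMate p₃ = p₁
rotationMate p₄ = p₂
opposite p₁ = p₄
opposite p₂ = p₃
opposite p₃ = p₂
opposite p₄ = p₁

knuthMate-involutive : ∀ j → knuthMate (knuthMate j) ≡ j
knuthMate-involutive p₁ = refl
knuthMate-involutive p₂ = refl
knuthMate-involutive p₃ = refl
knuthMate-involutive p₄ = refl

rotationMate-involutive : ∀ j → rotationMate (rotationMate j) ≡ j
rotationMate-involutive p₁ = refl
rotationMate-involutive p₂ = refl
rotationMate-involutive p₃ = refl
rotationMate-involutive p₄ = refl

knuthMate∘rotationMate : ∀ j → knuthMate (rotationMate j) ≡ opposite j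
knuthMate∘rotationMate p₁ = refl
knuthMate∘rotationMate p₂ = refl
knuthMate∘rotationMate p₃ = refl
knuthMate∘rotationMate p₄ = refl

rotationMate∘knuthMate : ∀ j → rotationMate (knuthMate j) ≡ opposite j
rotationMate∘knuthMate p₁ = refl
rotationMate∘knuthMate p₂ = refl
rotationMate∘knuthMate p₃ = refl
rotationMate∘knuthMate p₄ = refl

knuthMate≢rotationMate : ∀ j → knuthMate j ≢ rotationMate j
knuthMate≢rotationMate p₁ ()
knuthMate≢rotationMate p₂ ()
knuthMate≢rotationMate p₃ ()
knuthMate≢rotationMate p₄ ()

data Adjacent : Pos → Pos → Set where
  knuth    : ∀ j → Adjacent j (knuthMate j)
  rotation : ∀ j → Adjacent j (rotationMate j)

Adjacent-irreflexive : Adjacent j k → j ≢ k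
Adjacent-irreflexive (knuth p₁) ()
Adjacent-irreflexive (knuth p₂) ()
Adjacent-irreflexive (knuth p₃) ()
Adjacent-irreflexive (knuth p₄) ()
Adjacent-irreflexive (rotation p₁) ()
Adjacent-irreflexive (rotation p₂) ()
Adjacent-irreflexive (rotation p₃) ()
Adjacent-irreflexive (rotation p₄) ()

index : Pos → ℕ
index p₁ = 0
index p₂ = 1
index p₃ = 2
index p₄ = 3

fromIndex : ℕ → Pos
fromIndex 0 = p₁
fromIndex 1 = p₂
fromIndex 2 = p₃
fromIndex _ = p₄

fromIndex-index : ∀ j → fromIndex (index j) ≡ j
fromIndex-index p₁ = refl
fromIndex-index p₂ = refl
fromIndex-index p₃ = refl
fromIndex-index p₄ = refl

index-injective : index j ≡ index k → j ≡ k
index-injective {j} {k} e =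
  trans (sym (fromIndex-index j)) (trans (cong fromIndex e) (fromIndex-index k))

_≟_ : (j k : Pos) → Dec (j ≡ k)
j ≟ k = map′ index-injective (cong index) (index j ℕ.≟ index k)

-- Patterns

Pattern : Set
Pattern = Bool × Bool × Bool × Bool

variable
  p q : Pattern

_!_ : Pattern → Pos → Bool
(b , _) ! p₁ = b
(_ , b , _) ! p₂ = b
(_ , _ , b , _) ! p₃ = b
(_ , _ , _ , b) ! p₄ = b

tabulate : (Pos → Bool) → Pattern
tabulate f = f p₁ , f p₂ , f p₃ , f p₄

!-tabulate : ∀ f j → tabulate f ! j ≡ f j
!-tabulate f p₁ = refl
!-tabulate f p₂ = refl
!-tabulate f p₃ = refl
!-tabulate f p₄ = refl

pattern-ext : (∀ j → p ! j ≡ q ! j) → p ≡ q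
pattern-ext {_ , _ , _ , _} {_ , _ , _ , _} eq =
  cong₂ _,_ (eq p₁) (cong₂ _,_ (eq p₂) (cong₂ _,_ (eq p₃) (eq p₄)))

tabulate-≡ : ∀ {f g} → tabulate f ≡ tabulate g ⇔ f ≗ g
tabulate-≡ {f} {g} = mk⇔
  (λ eq j → trans (sym (!-tabulate f j)) (trans (cong (_! j) eq) (!-tabulate g j)))
  (λ f≗g → pattern-ext λ j → trans (!-tabulate f j) (trans (f≗g j) (sym (!-tabulate g j))))

∅ full : Pattern
∅ = tabulate λ _ → false
full = tabulate λ _ → true

edgePattern : Pos → Pos → Pattern
edgePattern j k = tabulate (λ m → does ((m ≟ j) ⊎-dec (m ≟ k)))

edgePattern-∋ : edgePattern j k ! m ≡ true ⇔ (m ≡ j ⊎ m ≡ k)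
edgePattern-∋ {j} {k} {m} =
  subst (λ b → b ≡ true ⇔ (m ≡ j ⊎ m ≡ k))
    (sym (!-tabulate (λ m → does ((m ≟ j) ⊎-dec (m ≟ k))) m))
    (does≡true⇔ ((m ≟ j) ⊎-dec (m ≟ k)))

data Admissible (p : Pattern) : Set where
  isEmpty : p ≡ ∅ → Admissible p
  isFull  : p ≡ full → Admissible p
  isEdge  : Adjacent j k → p ≡ edgePattern j k → Admissible p

-- ⟨bac − bca − acb + cab, Σ_W⟩ as a function of the pattern of W, written exactly as pairW
-- unfolds, so that the two agree definitionally.
signedCount : Pattern → ℤ
signedCount (b₁ , b₂ , b₃ , b₄) =
  (if b₁ then + 1 else + 0) +ℤ ((if b₂ then -[1+ 0 ] else + 0) +ℤ
  ((if b₃ then -[1+ 0 ] else + 0) +ℤ ((if b₄ then + 1 else + 0) +ℤ + 0)))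

admissible⇒signedCount≡0 : Admissible p → signedCount p ≡ + 0
admissible⇒signedCount≡0 (isEmpty refl)              = refl
admissible⇒signedCount≡0 (isFull refl)               = refl
admissible⇒signedCount≡0 (isEdge (knuth p₁) refl)    = refl
admissible⇒signedCount≡0 (isEdge (knuth p₂) refl)    = refl
admissible⇒signedCount≡0 (isEdge (knuth p₃) refl)    = refl
admissible⇒signedCount≡0 (isEdge (knuth p₄) refl)    = refl
admissible⇒signedCount≡0 (isEdge (rotation p₁) refl) = refl
admissible⇒signedCount≡0 (isEdge (rotation p₂) refl) = refl
admissible⇒signedCount≡0 (isEdge (rotation p₃) refl) = refl
admissible⇒signedCount≡0 (isEdge (rotation p₄) refl) = refl

signedCount≡0⇒admissible : ∀ p → signedCount p ≡ + 0 → Admissible p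
signedCount≡0⇒admissible (false , false , false , false) _ = isEmpty refl
signedCount≡0⇒admissible (false , false , false , true)  ()
signedCount≡0⇒admissible (false , false , true  , false) ()
signedCount≡0⇒admissible (false , false , true  , true)  _ = isEdge (knuth p₃) refl
signedCount≡0⇒admissible (false , true  , false , false) ()
signedCount≡0⇒admissible (false , true  , false , true)  _ = isEdge (rotation p₂) refl
signedCount≡0⇒admissible (false , true  , true  , false) ()
signedCount≡0⇒admissible (false , true  , true  , true)  ()
signedCount≡0⇒admissible (true  , false , false , false) ()
signedCount≡0⇒admissible (true  , false , false , true)  ()
signedCount≡0⇒admissible (true  , false , true  , false) _ = isEdge (rotation p₁) refl
signedCount≡0⇒admissible (true  , false , true  , true)  ()
signedCount≡0⇒admissible (true  , true  , false , false) _ = isEdge (knuth p₁) refl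
signedCount≡0⇒admissible (true  , true  , false , true)  ()
signedCount≡0⇒admissible (true  , true  , true  , false) ()
signedCount≡0⇒admissible (true  , true  , true  , true)  _ = isFull refl

admissible-if-marked : (∀ j → p ! j ≡ true → Admissible p) → Admissible p
admissible-if-marked {true  , _     , _     , _}     h = h p₁ refl
admissible-if-marked {false , true  , _     , _}     h = h p₂ refl
admissible-if-marked {false , false , true  , _}     h = h p₃ refl
admissible-if-marked {false , false , false , true}  h = h p₄ refl
admissible-if-marked {false , false , false , false} _ = isEmpty refl

-- Perfect matchings

record PerfectMatching (p : Pattern) (R : Pos → Pos → Set) : Set where
  field
    symmetric : R j k → R k j
    adjacent  : R j k → Adjacent j k
    marked    : R j k → p ! k ≡ true
    partnerOf : ∀ j → p ! j ≡ true → ∃ (R j)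
    unique    : R j k → R j m → k ≡ m

-- The Knuth mate is preferred, so that the full pattern is matched along Knuth edges.
partner : Pattern → Pos → Pos
partner p j = if p ! knuthMate j then knuthMate j else rotationMate j

partner-adjacent : ∀ p j → Adjacent j (partner p j)
partner-adjacent p j with p ! knuthMate j
... | true  = knuth j
... | false = rotation j

partner-edgePattern : Adjacent j k →
  partner (edgePattern j k) j ≡ k × partner (edgePattern j k) k ≡ j
partner-edgePattern (knuth p₁)    = refl , refl
partner-edgePattern (knuth p₂)    = refl , refl
partner-edgePattern (knuth p₃)    = refl , refl
partner-edgePattern (knuth p₄)    = refl , refl
partner-edgePattern (rotation p₁) = refl , refl
partner-edgePattern (rotation p₂) = refl , refl
partner-edgePattern (rotation p₃) = refl , refl
partner-edgePattern (rotation p₄) = refl , refl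

partner-involution : Admissible p → ∀ j → p ! j ≡ true →
  p ! partner p j ≡ true × partner p (partner p j) ≡ j
partner-involution (isEmpty refl) p₁ ()
partner-involution (isEmpty refl) p₂ ()
partner-involution (isEmpty refl) p₃ ()
partner-involution (isEmpty refl) p₄ ()
partner-involution (isFull refl) p₁ _ = refl , refl
partner-involution (isFull refl) p₂ _ = refl , refl
partner-involution (isFull refl) p₃ _ = refl , refl
partner-involution (isFull refl) p₄ _ = refl , refl
partner-involution (isEdge {j} {k} adj refl) m marked
  with Equivalence.to (edgePattern-∋ {j} {k} {m}) marked | partner-edgePattern adj
... | inj₁ refl | j↦k , k↦j rewrite j↦k | k↦j =
  Equivalence.from (edgePattern-∋ {j} {k} {k}) (inj₂ refl) , refl
... | inj₂ refl | j↦k , k↦j rewrite k↦j | j↦k =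
  Equivalence.from (edgePattern-∋ {j} {k} {j}) (inj₁ refl) , refl

data Matched (p : Pattern) : Pos → Pos → Set where
  matched : ∀ {j} → p ! j ≡ true → Matched p j (partner p j)

Matched⇒marked : Matched p j k → p ! j ≡ true
Matched⇒marked (matched marked) = marked

admissible⇒perfectMatching : Admissible p → PerfectMatching p (Matched p)
admissible⇒perfectMatching {p} A = record
  { symmetric = λ { {j} (matched marked) →
      subst (Matched p _) (proj₂ (partner-involution A j marked))
            (matched (proj₁ (partner-involution A j marked))) }
  ; adjacent  = λ { {j} (matched _) → partner-adjacent p j }
  ; marked    = λ { {j} (matched marked) → proj₁ (partner-involution A j marked) }
  ; partnerOf = λ _ marked → _ , matched marked
  ; unique    = λ { (matched _) (matched _) → refl }
  }

module _ {p : Pattern} {R : Pos → Pos → Set} (M : PerfectMatching p R) where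
  open PerfectMatching M

  matched-to-rotationMate : ∀ j → p ! j ≡ true → p ! knuthMate j ≡ false → R j (rotationMate j)
  matched-to-rotationMate j j∈ km∉ with partnerOf j j∈
  ... | _ , Rjk with adjacent Rjk
  ...   | knuth _    = ⊥-elim (not-¬ (marked Rjk) km∉)
  ...   | rotation _ = Rjk

  matched-to-knuthMate : ∀ j → p ! j ≡ true → p ! rotationMate j ≡ false → R j (knuthMate j)
  matched-to-knuthMate j j∈ rm∉ with partnerOf j j∈
  ... | _ , Rjk with adjacent Rjk
  ...   | knuth _    = Rjk
  ...   | rotation _ = ⊥-elim (not-¬ (marked Rjk) rm∉)

  no-isolated : ∀ j → p ! j ≡ true → p ! knuthMate j ≡ false → p ! rotationMate j ≡ false → ⊥
  no-isolated j j∈ km∉ rm∉ = not-¬ (marked (matched-to-rotationMate j j∈ km∉)) rm∉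

  -- The neighbour of j not matched to j has j as its only marked neighbour, so it is matched to j too.
  no-fork : ∀ j → p ! j ≡ true → p ! knuthMate j ≡ true → p ! rotationMate j ≡ true →
            p ! opposite j ≡ false → ⊥
  no-fork j j∈ km∈ rm∈ opp∉ with partnerOf j j∈
  ... | _ , Rjk with adjacent Rjk
  ...   | knuth _ = knuthMate≢rotationMate j (unique Rjk (symmetric back))
    where
    back : R (rotationMate j) j
    back = subst (R (rotationMate j)) (rotationMate-involutive j)
             (matched-to-rotationMate (rotationMate j) rm∈
               (trans (cong (p !_) (knuthMate∘rotationMate j)) opp∉))
  ...   | rotation _ = knuthMate≢rotationMate j (sym (unique Rjk (symmetric back)))
    where
    back : R (knuthMate j) j
    back = subst (R (knuthMate j)) (knuthMate-involutive j)
             (matched-to-knuthMate (knuthMate j) km∈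
               (trans (cong (p !_) (rotationMate∘knuthMate j)) opp∉))

perfectMatching⇒admissible : ∀ p {R} → PerfectMatching p R → Admissible p
perfectMatching⇒admissible (false , false , false , false) M = isEmpty refl
perfectMatching⇒admissible (false , false , false , true)  M = ⊥-elim (no-isolated M p₄ refl refl refl)
perfectMatching⇒admissible (false , false , true  , false) M = ⊥-elim (no-isolated M p₃ refl refl refl)
perfectMatching⇒admissible (false , false , true  , true)  M = isEdge (knuth p₃) refl
perfectMatching⇒admissible (false , true  , false , false) M = ⊥-elim (no-isolated M p₂ refl refl refl)
perfectMatching⇒admissible (false , true  , false , true)  M = isEdge (rotation p₂) refl
perfectMatching⇒admissible (false , true  , true  , false) M = ⊥-elim (no-isolated M p₂ refl refl refl)
perfectMatching⇒admissible (false , true  , true  , true)  M = ⊥-elim (no-fork M p₄ refl refl refl refl)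
perfectMatching⇒admissible (true  , false , false , false) M = ⊥-elim (no-isolated M p₁ refl refl refl)
perfectMatching⇒admissible (true  , false , false , true)  M = ⊥-elim (no-isolated M p₁ refl refl refl)
perfectMatching⇒admissible (true  , false , true  , false) M = isEdge (rotation p₁) refl
perfectMatching⇒admissible (true  , false , true  , true)  M = ⊥-elim (no-fork M p₃ refl refl refl refl)
perfectMatching⇒admissible (true  , true  , false , false) M = isEdge (knuth p₁) refl
perfectMatching⇒admissible (true  , true  , false , true)  M = ⊥-elim (no-fork M p₂ refl refl refl refl)
perfectMatching⇒admissible (true  , true  , true  , false) M = ⊥-elim (no-fork M p₁ refl refl refl refl)
perfectMatching⇒admissible (true  , true  , true  , true)  M = isFull refl

-- The words of a KR square

module _ {N : ℕ} where

  window : Pos → Fin N → Fin N → Fin N → Word N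
  window p₁ α β γ = β ∷ α ∷ γ ∷ []
  window p₂ α β γ = β ∷ γ ∷ α ∷ []
  window p₃ α β γ = α ∷ γ ∷ β ∷ []
  window p₄ α β γ = γ ∷ α ∷ β ∷ []

  corner : Word N → Word N → Fin N → Fin N → Fin N → Pos → Word N
  corner pre suf α β γ j = pre ++ window j α β γ ++ suf

  entry : KRSquare N → Pos → Word N
  entry X = corner (v X) (w X) (a X) (b X) (c X)

  entry∈entries : ∀ X j → entry X j ∈ entries X
  entry∈entries X p₁ = here refl
  entry∈entries X p₂ = there (here refl)
  entry∈entries X p₃ = there (there (here refl))
  entry∈entries X p₄ = there (there (there (here refl)))

  ∈entries⇒entry : ∀ X {z} → z ∈ entries X → ∃ λ j → z ≡ entry X j
  ∈entries⇒entry X (here z≡)                         = p₁ , z≡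
  ∈entries⇒entry X (there (here z≡))                 = p₂ , z≡
  ∈entries⇒entry X (there (there (here z≡)))         = p₃ , z≡
  ∈entries⇒entry X (there (there (there (here z≡)))) = p₄ , z≡

  ∀-entries : ∀ X {P : Word N → Set} → (∀ z → z ∈ entries X → P z) ⇔ (∀ j → P (entry X j))
  ∀-entries X {P} = mk⇔ (λ h j → h _ (entry∈entries X j)) from
    where
    from : (∀ j → P (entry X j)) → ∀ z → z ∈ entries X → P z
    from h z z∈ with ∈entries⇒entry X z∈
    ... | j , refl = h j

  patternOf : Subset N → KRSquare N → Pattern
  patternOf W X = tabulate (W ∘ entry X)

  -- The relative order of the three letters of a window determines its position.
  shape : Word N → Pos
  shape (x ∷ y ∷ z ∷ _) =
    if does (x F.<? y) then (if does (x F.<? z) then p₃ else p₂)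
                       else (if does (x F.<? z) then p₁ else p₄)
  shape _ = p₁

  shape-window : ∀ {α β γ} → α F.< β → β F.< γ → ∀ j → shape (window j α β γ) ≡ j
  shape-window {α} {β} {γ} α<β β<γ p₁
    rewrite dec-false (β F.<? α) (FP.<-asym α<β) | dec-true (β F.<? γ) β<γ = refl
  shape-window {α} {β} {γ} α<β β<γ p₂
    rewrite dec-true (β F.<? γ) β<γ | dec-false (β F.<? α) (FP.<-asym α<β) = refl
  shape-window {α} {β} {γ} α<β β<γ p₃
    rewrite dec-true (α F.<? γ) (FP.<-trans α<β β<γ) | dec-true (α F.<? β) α<β = refl
  shape-window {α} {β} {γ} α<β β<γ p₄
    rewrite dec-false (γ F.<? α) (FP.<-asym (FP.<-trans α<β β<γ))
          | dec-false (γ F.<? β) (FP.<-asym β<γ) = refl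

  window-injective : ∀ j {α β γ α′ β′ γ′} → window j α β γ ≡ window j α′ β′ γ′ →
                     α ≡ α′ × β ≡ β′ × γ ≡ γ′
  window-injective p₁ refl = refl , refl , refl
  window-injective p₂ refl = refl , refl , refl
  window-injective p₃ refl = refl , refl , refl
  window-injective p₄ refl = refl , refl , refl

  length-window : ∀ j {α β γ} → length (window j α β γ) ≡ 3
  length-window p₁ = refl
  length-window p₂ = refl
  length-window p₃ = refl
  length-window p₄ = refl

  corner-rigid : ∀ {pre suf pre′ suf′} {α β γ α′ β′ γ′ : Fin N} →
    α F.< β → β F.< γ → α′ F.< β′ → β′ F.< γ′ → length pre ≡ length pre′ →
    corner pre suf α β γ j ≡ corner pre′ suf′ α′ β′ γ′ k →
    j ≡ k × corner pre suf α β γ ≗ corner pre′ suf′ α′ β′ γ′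
  corner-rigid {j} {k} {pre} {suf} {pre′} {suf′} {α} {β} {γ} {α′} {β′} {γ′}
               α<β β<γ α′<β′ β′<γ′ |pre|≡ eq
    with ++-injective pre pre′ |pre|≡ eq
  ... | refl , eq′
    with ++-injective (window j α β γ) (window k α′ β′ γ′)
                      (trans (length-window j) (sym (length-window k))) eq′
  ... | windows≡ , refl with j≡k
    where
    j≡k : j ≡ k
    j≡k = trans (sym (shape-window α<β β<γ j))
                (trans (cong shape windows≡) (shape-window α′<β′ β′<γ′ k))
  ... | refl with window-injective j windows≡
  ... | refl , refl , refl = refl , λ _ → refl

  entry-rigid : ∀ (X X′ : KRSquare N) → length (v X) ≡ length (v X′) →
                entry X j ≡ entry X′ k → j ≡ k × entry X ≗ entry X′
  entry-rigid X X′ =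
    corner-rigid {pre = v X} {w X} {v X′} {w X′} (a<b X) (b<c X) (a<b X′) (b<c X′)

  entry-injective : ∀ (X : KRSquare N) → entry X j ≡ entry X k → j ≡ k
  entry-injective X = proj₁ ∘ entry-rigid X X refl

-- Knuth and rotation transformations

mark : ℕ → Bool → List ℕ → List ℕ
mark i true  is = is
mark i false is = i ∷ is

-- A Knuth transformation changes two adjacent letters and a rotation three consecutive ones,
-- while the diagonals of a square differ exactly at positions i and i + 2.
data StartsWithRun : List ℕ → Set where
  run : ∀ i is → StartsWithRun (i ∷ suc i ∷ is)

module _ {N : ℕ} where

  mismatches : ℕ → Word N → Word N → List ℕ
  mismatches i (x ∷ xs) (y ∷ ys) = mark i (does (x F.≟ y)) (mismatches (suc i) xs ys)
  mismatches i _        _        = []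

  ≟-refl : (x : Fin N) → does (x F.≟ x) ≡ true
  ≟-refl x = dec-true (x F.≟ x) refl

  ≟-< : ∀ {x y : Fin N} → x F.< y → does (x F.≟ y) ≡ false
  ≟-< {x} {y} x<y = dec-false (x F.≟ y) (FP.<⇒≢ x<y)

  ≟-> : ∀ {x y : Fin N} → y F.< x → does (x F.≟ y) ≡ false
  ≟-> {x} {y} y<x = dec-false (x F.≟ y) (FP.<⇒≢ y<x ∘ sym)

  mismatches-self : ∀ i (xs : Word N) → mismatches i xs xs ≡ []
  mismatches-self i []       = refl
  mismatches-self i (x ∷ xs) rewrite ≟-refl x = mismatches-self (suc i) xs

  mismatches-window : ∀ i pre suf (x₁ x₂ x₃ y₁ y₂ y₃ : Fin N) →
    mismatches i (pre ++ x₁ ∷ x₂ ∷ x₃ ∷ suf) (pre ++ y₁ ∷ y₂ ∷ y₃ ∷ suf) ≡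
    mark (length pre + i) (does (x₁ F.≟ y₁)) (mark (suc (length pre + i)) (does (x₂ F.≟ y₂))
      (mark (suc (suc (length pre + i))) (does (x₃ F.≟ y₃)) []))
  mismatches-window i [] suf _ _ _ _ _ _ rewrite mismatches-self (3 + i) suf = refl
  mismatches-window i (x ∷ pre) suf x₁ x₂ x₃ y₁ y₂ y₃
    rewrite ≟-refl x | mismatches-window (suc i) pre suf x₁ x₂ x₃ y₁ y₂ y₃
          | ℕP.+-suc (length pre) i = refl

  knuth⇒run : ∀ {x y : Word N} → Knuth x y → StartsWithRun (mismatches 0 x y)
  knuth⇒run (k₁ pre suf {α} {β} {γ} α<β β<γ)
    rewrite mismatches-window 0 pre suf β α γ β γ α
          | ≟-refl β | ≟-< (FP.<-trans α<β β<γ) | ≟-> (FP.<-trans α<β β<γ) = run _ _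
  knuth⇒run (k₂ pre suf {α} {β} {γ} α<β β<γ)
    rewrite mismatches-window 0 pre suf β γ α β α γ
          | ≟-refl β | ≟-> (FP.<-trans α<β β<γ) | ≟-< (FP.<-trans α<β β<γ) = run _ _
  knuth⇒run (k₃ pre suf {α} {β} {γ} α<β β<γ)
    rewrite mismatches-window 0 pre suf α γ β γ α β
          | ≟-< (FP.<-trans α<β β<γ) | ≟-> (FP.<-trans α<β β<γ) | ≟-refl β = run _ _
  knuth⇒run (k₄ pre suf {α} {β} {γ} α<β β<γ)
    rewrite mismatches-window 0 pre suf γ α β α γ β
          | ≟-> (FP.<-trans α<β β<γ) | ≟-< (FP.<-trans α<β β<γ) | ≟-refl β = run _ _

  rotation⇒run : ∀ {x y : Word N} → Rotation x y → StartsWithRun (mismatches 0 x y)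
  rotation⇒run (r₁ pre suf {α} {β} {γ} α<β β<γ)
    rewrite mismatches-window 0 pre suf β α γ α γ β
          | ≟-> α<β | ≟-< (FP.<-trans α<β β<γ) | ≟-> β<γ = run _ _
  rotation⇒run (r₂ pre suf {α} {β} {γ} α<β β<γ)
    rewrite mismatches-window 0 pre suf α γ β β α γ
          | ≟-< α<β | ≟-> (FP.<-trans α<β β<γ) | ≟-< β<γ = run _ _
  rotation⇒run (r₃ pre suf {α} {β} {γ} α<β β<γ)
    rewrite mismatches-window 0 pre suf β γ α γ α β
          | ≟-< β<γ | ≟-> (FP.<-trans α<β β<γ) | ≟-< α<β = run _ _
  rotation⇒run (r₄ pre suf {α} {β} {γ} α<β β<γ)
    rewrite mismatches-window 0 pre suf γ α β β γ α
          | ≟-> β<γ | ≟-< (FP.<-trans α<β β<γ) | ≟-> α<β = run _ _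

  Related : Word N → Word N → Set
  Related x y = Knuth x y ⊎ Rotation x y

  related⇒run : ∀ {x y : Word N} → Related x y → StartsWithRun (mismatches 0 x y)
  related⇒run (inj₁ k) = knuth⇒run k
  related⇒run (inj₂ r) = rotation⇒run r

  no-run-at-distance-two : ∀ i → ¬ StartsWithRun (i ∷ suc (suc i) ∷ [])
  no-run-at-distance-two i ()

  no-run-in-[] : ¬ StartsWithRun []
  no-run-in-[] ()

  not-self-related : ∀ (x : Word N) → ¬ Related x x
  not-self-related x rel = no-run-in-[] (subst StartsWithRun (mismatches-self 0 x) (related⇒run rel))

  related⇒adjacent : ∀ X j k → Related (entry X j) (entry X k) → Adjacent j k
  related⇒adjacent X p₁ p₂ _ = knuth p₁
  related⇒adjacent X p₂ p₁ _ = knuth p₂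
  related⇒adjacent X p₃ p₄ _ = knuth p₃
  related⇒adjacent X p₄ p₃ _ = knuth p₄
  related⇒adjacent X p₁ p₃ _ = rotation p₁
  related⇒adjacent X p₃ p₁ _ = rotation p₃
  related⇒adjacent X p₂ p₄ _ = rotation p₂
  related⇒adjacent X p₄ p₂ _ = rotation p₄
  related⇒adjacent X p₁ p₁ rel = ⊥-elim (not-self-related _ rel)
  related⇒adjacent X p₂ p₂ rel = ⊥-elim (not-self-related _ rel)
  related⇒adjacent X p₃ p₃ rel = ⊥-elim (not-self-related _ rel)
  related⇒adjacent X p₄ p₄ rel = ⊥-elim (not-self-related _ rel)
  related⇒adjacent X p₁ p₄ rel with related⇒run rel
  ... | r rewrite mismatches-window 0 (v X) (w X) (b X) (a X) (c X) (c X) (a X) (b X)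
                | ≟-< (b<c X) | ≟-refl (a X) | ≟-> (b<c X) = ⊥-elim (no-run-at-distance-two _ r)
  related⇒adjacent X p₄ p₁ rel with related⇒run rel
  ... | r rewrite mismatches-window 0 (v X) (w X) (c X) (a X) (b X) (b X) (a X) (c X)
                | ≟-> (b<c X) | ≟-refl (a X) | ≟-< (b<c X) = ⊥-elim (no-run-at-distance-two _ r)
  related⇒adjacent X p₂ p₃ rel with related⇒run rel
  ... | r rewrite mismatches-window 0 (v X) (w X) (b X) (c X) (a X) (a X) (c X) (b X)
                | ≟-> (a<b X) | ≟-refl (c X) | ≟-< (a<b X) = ⊥-elim (no-run-at-distance-two _ r)
  related⇒adjacent X p₃ p₂ rel with related⇒run rel
  ... | r rewrite mismatches-window 0 (v X) (w X) (a X) (c X) (b X) (b X) (c X) (a X)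
                | ≟-< (a<b X) | ≟-refl (c X) | ≟-> (a<b X) = ⊥-elim (no-run-at-distance-two _ r)

  adjacent⇒related : ∀ X → Adjacent j k → Related (entry X j) (entry X k)
  adjacent⇒related X (knuth p₁)    = inj₁ (k₁ (v X) (w X) (a<b X) (b<c X))
  adjacent⇒related X (knuth p₂)    = inj₁ (k₂ (v X) (w X) (a<b X) (b<c X))
  adjacent⇒related X (knuth p₃)    = inj₁ (k₃ (v X) (w X) (a<b X) (b<c X))
  adjacent⇒related X (knuth p₄)    = inj₁ (k₄ (v X) (w X) (a<b X) (b<c X))
  adjacent⇒related X (rotation p₁) = inj₂ (r₁ (v X) (w X) (a<b X) (b<c X))
  adjacent⇒related X (rotation p₂) = inj₂ (r₃ (v X) (w X) (a<b X) (b<c X))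
  adjacent⇒related X (rotation p₃) = inj₂ (r₂ (v X) (w X) (a<b X) (b<c X))
  adjacent⇒related X (rotation p₄) = inj₂ (r₄ (v X) (w X) (a<b X) (b<c X))

-- Squares of 𝒲ₙ

module _ {N : ℕ} where

  window-↭-sorted : ∀ j {α β γ : Fin N} → window j α β γ ↭ α ∷ β ∷ γ ∷ []
  window-↭-sorted p₁ = swap _ _ ↭.refl
  window-↭-sorted p₂ = ↭.trans (prep _ (swap _ _ ↭.refl)) (swap _ _ ↭.refl)
  window-↭-sorted p₃ = prep _ (swap _ _ ↭.refl)
  window-↭-sorted p₄ = ↭.trans (swap _ _ ↭.refl) (prep _ (swap _ _ ↭.refl))

  corner-↭ : ∀ pre suf {α β γ : Fin N} j k →
             corner pre suf α β γ j ↭ corner pre suf α β γ k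
  corner-↭ pre suf j k = ↭P.++⁺ˡ pre (↭P.++⁺ʳ suf
    (↭.trans (window-↭-sorted j) (↭.↭-sym (window-↭-sorted k))))

  corner-unique : ∀ pre suf {α β γ : Fin N} j k →
                  Unique (corner pre suf α β γ j) → Unique (corner pre suf α β γ k)
  corner-unique pre suf j k = PermS.Unique-resp-↭ (setoid (Fin N)) (↭⇒↭ₛ (corner-↭ pre suf j k))

  squareAt : ∀ pre suf {α β γ : Fin N} → α F.< β → β F.< γ → ∀ j →
             Unique (corner pre suf α β γ j) → KRSquare N
  squareAt pre suf α<β β<γ j u = record
    { v = pre ; w = suf ; a<b = α<β ; b<c = β<γ
    ; u₁ = corner-unique pre suf j p₁ u ; u₂ = corner-unique pre suf j p₂ u
    ; u₃ = corner-unique pre suf j p₃ u ; u₄ = corner-unique pre suf j p₄ u }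

  length-entry : ∀ (X : KRSquare N) j → length (entry X j) ≡ length (v X) + (3 + length (w X))
  length-entry X p₁ = LP.length-++ (v X)
  length-entry X p₂ = LP.length-++ (v X)
  length-entry X p₃ = LP.length-++ (v X)
  length-entry X p₄ = LP.length-++ (v X)

  entry-unique : ∀ (X : KRSquare N) j → Unique (entry X j)
  entry-unique X p₁ = u₁ X
  entry-unique X p₂ = u₂ X
  entry-unique X p₃ = u₃ X
  entry-unique X p₄ = u₄ X

  entry∈𝒲⇒KRof : ∀ {n} (X : KRSquare N) j → InW n (entry X j) → KRof n X
  entry∈𝒲⇒KRof {n} X j (|x|≡n , _) = Equivalence.from (∀-entries X {InW n}) λ m →
    trans (length-entry X m) (trans (sym (length-entry X j)) |x|≡n) ,
    entry-unique X m

-- Condition (ii)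

AdmissibleOnSquares : {N : ℕ} → ℕ → Subset N → Set
AdmissibleOnSquares {N} n W = (X : KRSquare N) → KRof n X → Admissible (patternOf W X)

module _ {N : ℕ} (W : Subset N) (X : KRSquare N) where

  LocalAt : Set
  LocalAt =
      (∀ z → z ∈ entries X → W z ≡ false)
    ⊎ (∀ z → z ∈ entries X → W z ≡ true)
    ⊎ (Σ (Word N) λ x → Σ (Word N) λ y →
         x ∈ entries X × y ∈ entries X × ¬ (x ≡ y)
         × (∀ z → z ∈ entries X → (W z ≡ true → z ≡ x ⊎ z ≡ y)
                                × (z ≡ x ⊎ z ≡ y → W z ≡ true))
         × Related x y)

  private
    entry≡⇒≡ : entry X m ≡ entry X j ⊎ entry X m ≡ entry X k → m ≡ j ⊎ m ≡ k
    entry≡⇒≡ = Data.Sum.map (entry-injective X) (entry-injective X)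

    ≡⇒entry≡ : m ≡ j ⊎ m ≡ k → entry X m ≡ entry X j ⊎ entry X m ≡ entry X k
    ≡⇒entry≡ = Data.Sum.map (cong (entry X)) (cong (entry X))

  admissible⇒local : Admissible (patternOf W X) → LocalAt
  admissible⇒local (isEmpty eq) =
    inj₁ (Equivalence.from (∀-entries X) (Equivalence.to tabulate-≡ eq))
  admissible⇒local (isFull eq) =
    inj₂ (inj₁ (Equivalence.from (∀-entries X) (Equivalence.to tabulate-≡ eq)))
  admissible⇒local (isEdge {j} {k} adj eq) = inj₂ (inj₂
    ( entry X j , entry X k , entry∈entries X j , entry∈entries X k
    , Adjacent-irreflexive adj ∘ entry-injective X
    , Equivalence.from (∀-entries X) (λ m → marked⇒ m , ⇒marked m)
    , adjacent⇒related X adj ))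
    where
    pointwise : ∀ m → W (entry X m) ≡ edgePattern j k ! m
    pointwise m = trans (sym (!-tabulate (W ∘ entry X) m)) (cong (_! m) eq)
    marked⇒ : ∀ m → W (entry X m) ≡ true → entry X m ≡ entry X j ⊎ entry X m ≡ entry X k
    marked⇒ m h = ≡⇒entry≡ (Equivalence.to edgePattern-∋ (trans (sym (pointwise m)) h))
    ⇒marked : ∀ m → entry X m ≡ entry X j ⊎ entry X m ≡ entry X k → W (entry X m) ≡ true
    ⇒marked m h = trans (pointwise m) (Equivalence.from edgePattern-∋ (entry≡⇒≡ h))

  local⇒admissible : LocalAt → Admissible (patternOf W X)
  local⇒admissible (inj₁ none) =
    isEmpty (Equivalence.from tabulate-≡ (Equivalence.to (∀-entries X) none))
  local⇒admissible (inj₂ (inj₁ all)) =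
    isFull (Equivalence.from tabulate-≡ (Equivalence.to (∀-entries X) all))
  local⇒admissible (inj₂ (inj₂ (x , y , x∈ , y∈ , _ , marked⇔ , rel)))
    with ∈entries⇒entry X x∈ | ∈entries⇒entry X y∈
  ... | j , refl | k , refl =
    isEdge (related⇒adjacent X j k rel) (pattern-ext λ m →
      trans (!-tabulate (W ∘ entry X) m) (⇔→≡ (mk⇔ (to m) (from m))))
    where
    to : ∀ m → W (entry X m) ≡ true → edgePattern j k ! m ≡ true
    to m h = Equivalence.from edgePattern-∋
               (entry≡⇒≡ (proj₁ (Equivalence.to (∀-entries X) marked⇔ m) h))
    from : ∀ m → edgePattern j k ! m ≡ true → W (entry X m) ≡ true
    from m h = proj₂ (Equivalence.to (∀-entries X) marked⇔ m)
                 (≡⇒entry≡ (Equivalence.to edgePattern-∋ h))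

local⇔admissible : {N : ℕ} (n : ℕ) (W : Subset N) → LocalKR n W ⇔ AdmissibleOnSquares n W
local⇔admissible n W = mk⇔
  (λ L X kr → local⇒admissible W X (L X kr))
  (λ A X kr → admissible⇒local W X (A X kr))

-- Condition (i)

module _ {N n : ℕ} {W : Subset N} where

  private
    marked⇒∈W : ∀ X j → patternOf W X ! j ≡ true → W (entry X j) ≡ true
    marked⇒∈W X j = trans (sym (!-tabulate (W ∘ entry X) j))

    ∈W⇒marked : ∀ X j → W (entry X j) ≡ true → patternOf W X ! j ≡ true
    ∈W⇒marked X j = trans (!-tabulate (W ∘ entry X) j)

  colour-bounds : ∀ (X : KRSquare N) → KRof n X → 2 ℕ.≤ length (v X) + 2 × length (v X) + 2 ℕ.≤ n ∸ 1
  colour-bounds X kr = ℕP.m≤n+m 2 (length (v X)) ,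
    subst (λ n → length (v X) + 2 ℕ.≤ n ∸ 1) (trans (sym (length-entry X p₁)) |e₁|≡n)
      (ℕP.≤-trans (ℕP.+-monoʳ-≤ (length (v X)) (ℕP.m≤m+n 2 (length (w X))))
               (ℕP.≤-reflexive (sym (ℕP.+-∸-assoc (length (v X)) (s≤s z≤n)))))
    where |e₁|≡n = proj₁ (kr _ (entry∈entries X p₁))

  module _ {E : ℕ → Word N → Word N → Set} (D : IsD0Graph n W E) where
    open IsD0Graph D

    d0-perfectMatching : ∀ (X : KRSquare N) → KRof n X →
      PerfectMatching (patternOf W X) (λ j k → E (length (v X) + 2) (entry X j) (entry X k))
    d0-perfectMatching X kr = record
      { symmetric = symmetric i _ _
      ; adjacent  = λ {j} {k} e → related⇒adjacent X j k (proj₂ (proj₂ (proj₂ (proj₂ (edgeKR i _ _ e)))))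
      ; marked    = λ {_} {k} e → ∈W⇒marked X k (proj₂ (onW i _ _ e))
      ; partnerOf = partnerOf
      ; unique    = unique
      }
      where
      i : ℕ
      i = length (v X) + 2
      X-is-KRᵢ : IsKR i X
      X-is-KRᵢ = sym (ℕP.m+n∸n≡m (length (v X)) 2)
      perfectAt : ∀ j → W (entry X j) ≡ true →
                  Σ (Word N) λ y → E i (entry X j) y × (∀ y′ → E i (entry X j) y′ → y′ ≡ y)
      perfectAt j = perfect i (proj₁ (colour-bounds X kr)) (proj₂ (colour-bounds X kr))
                            X X-is-KRᵢ (entry X j) (entry∈entries X j)
      partnerOf : ∀ j → patternOf W X ! j ≡ true → ∃ λ k → E i (entry X j) (entry X k)
      partnerOf j marked with perfectAt j (marked⇒∈W X j marked)
      ... | y , e , _ with edgeKR i _ _ e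
      ... | X′ , X′-is-KRᵢ , x∈ , y∈ , _ with ∈entries⇒entry X′ x∈ | ∈entries⇒entry X′ y∈
      ... | j′ , x≡ | k′ , refl with entry-rigid X X′ (trans X-is-KRᵢ (sym X′-is-KRᵢ)) x≡
      ... | _ , X≗X′ = k′ , subst (E i (entry X j)) (sym (X≗X′ k′)) e
      unique : ∀ {j k m} → E i (entry X j) (entry X k) → E i (entry X j) (entry X m) → k ≡ m
      unique {j} e e′ with perfectAt j (proj₁ (onW i _ _ e))
      ... | _ , _ , only = entry-injective X (trans (only _ e) (sym (only _ e′)))

  d0⇒admissible : D0VertexSet n W → AdmissibleOnSquares n W
  d0⇒admissible (E , D) X kr = perfectMatching⇒admissible _ (d0-perfectMatching D X kr)

  module _ (W⊆𝒲 : W ⊆W n) (A : AdmissibleOnSquares n W) where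

    matchingAt : ∀ X j → patternOf W X ! j ≡ true →
                 PerfectMatching (patternOf W X) (Matched (patternOf W X))
    matchingAt X j marked = admissible⇒perfectMatching
      (A X (entry∈𝒲⇒KRof X j (W⊆𝒲 _ (marked⇒∈W X j marked))))

    matchingOf : ∀ X → Matched (patternOf W X) j k →
                 PerfectMatching (patternOf W X) (Matched (patternOf W X))
    matchingOf {j} X jk = matchingAt X j (Matched⇒marked jk)

    -- The i-edges are the canonical matchings of the patterns of the KRᵢ squares.
    KREdge : ℕ → Word N → Word N → Set
    KREdge i x y = Σ (KRSquare N) λ X → IsKR i X × (2 ℕ.≤ i × i ℕ.≤ n ∸ 1) ×
                   Σ Pos λ j → Σ Pos λ k → x ≡ entry X j × y ≡ entry X k × Matched (patternOf W X) j k

    KREdge-isD0Graph : IsD0Graph n W KREdge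
    KREdge-isD0Graph = record
      { symmetric = λ { _ _ _ (X , X-KRᵢ , bounds , j , k , x≡ , y≡ , jk) →
          X , X-KRᵢ , bounds , k , j , y≡ , x≡ , PerfectMatching.symmetric (matchingOf X jk) jk }
      ; onW = λ { _ _ _ (X , _ , _ , j , k , refl , refl , jk) →
          marked⇒∈W X j (Matched⇒marked jk) , marked⇒∈W X k (PerfectMatching.marked (matchingOf X jk) jk) }
      ; colours = λ { _ _ _ (_ , _ , bounds , _) → bounds }
      ; edgeKR = λ { _ _ _ (X , X-KRᵢ , _ , j , k , refl , refl , jk) →
          X , X-KRᵢ , entry∈entries X j , entry∈entries X k ,
          adjacent⇒related X (PerfectMatching.adjacent (matchingOf X jk) jk) }
      ; perfect = perfect
      }
      where
      perfect : ∀ i → 2 ℕ.≤ i → i ℕ.≤ n ∸ 1 → (X : KRSquare N) → IsKR i X →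
                ∀ x → x ∈ entries X → W x ≡ true →
                Σ (Word N) λ y → KREdge i x y × (∀ y′ → KREdge i x y′ → y′ ≡ y)
      perfect i 2≤i i≤n-1 X X-KRᵢ x x∈ x∈W with ∈entries⇒entry X x∈
      ... | j , refl with PerfectMatching.partnerOf M j marked
        where
        marked = ∈W⇒marked X j x∈W
        M = matchingAt X j marked
      ... | k , jk = entry X k , (X , X-KRᵢ , (2≤i , i≤n-1) , j , k , refl , refl , jk) , only
        where
        only : ∀ y′ → KREdge i (entry X j) y′ → y′ ≡ entry X k
        only _ (X′ , X′-KRᵢ , _ , j′ , k′ , x≡ , refl , jk′)
          with entry-rigid X X′ (trans X-KRᵢ (sym X′-KRᵢ)) x≡
        ... | refl , X≗X′ =
          trans (sym (X≗X′ k′)) (cong (entry X) (PerfectMatching.unique (matchingOf X jk) jk′′ jk))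
          where
          jk′′ : Matched (patternOf W X) j k′
          jk′′ = subst (λ p → Matched p j k′)
                   (sym (Equivalence.from tabulate-≡ (cong W ∘ X≗X′))) jk′

  d0⇔admissible : W ⊆W n → D0VertexSet n W ⇔ AdmissibleOnSquares n W
  d0⇔admissible W⊆𝒲 = mk⇔ d0⇒admissible λ A → KREdge W⊆𝒲 A , KREdge-isD0Graph W⊆𝒲 A

-- Condition (iii)

module _ {N : ℕ} where

  sandwich : Word N → Word N → Poly N → Poly N
  sandwich pre suf z = lmulP pre (rmulP z suf)

  sandwich-++ : ∀ pre suf (p q : Poly N) →
                sandwich pre suf (p ++ q) ≡ sandwich pre suf p ++ sandwich pre suf q
  sandwich-++ pre suf []            q = refl
  sandwich-++ pre suf ((k , x) ∷ p) q =
    cong ((k , pre ++ x ++ suf) ∷_) (sandwich-++ pre suf p q)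

  sandwich-scale : ∀ pre suf m (p : Poly N) →
                   sandwich pre suf (scaleP m p) ≡ scaleP m (sandwich pre suf p)
  sandwich-scale pre suf m []            = refl
  sandwich-scale pre suf m ((k , x) ∷ p) =
    cong ((m *ℤ k , pre ++ x ++ suf) ∷_) (sandwich-scale pre suf m p)

  sandwich-lmul : ∀ pre suf u (p : Poly N) →
                  sandwich pre suf (lmulP u p) ≡ sandwich (pre ++ u) suf p
  sandwich-lmul pre suf u []            = refl
  sandwich-lmul pre suf u ((k , x) ∷ p) = cong₂ _∷_
    (cong (k ,_) (trans (cong (pre ++_) (LP.++-assoc u x suf)) (sym (LP.++-assoc pre u (x ++ suf)))))
    (sandwich-lmul pre suf u p)

  sandwich-rmul : ∀ pre suf u (p : Poly N) →
                  sandwich pre suf (rmulP p u) ≡ sandwich pre (u ++ suf) p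
  sandwich-rmul pre suf u []            = refl
  sandwich-rmul pre suf u ((k , x) ∷ p) = cong₂ _∷_
    (cong (k ,_) (cong (pre ++_) (LP.++-assoc x u suf)))
    (sandwich-rmul pre suf u p)

  sandwich-identity : (p : Poly N) → sandwich [] [] p ≡ p
  sandwich-identity []            = refl
  sandwich-identity ((k , x) ∷ p) =
    cong₂ _∷_ (cong (k ,_) (LP.++-identityʳ x)) (sandwich-identity p)

  pairW-++ : ∀ W (p q : Poly N) → pairW W (p ++ q) ≡ pairW W p +ℤ pairW W q
  pairW-++ W []            q = sym (ℤP.+-identityˡ _)
  pairW-++ W ((k , x) ∷ p) q rewrite pairW-++ W p q =
    sym (ℤP.+-assoc (if W x then k else + 0) (pairW W p) (pairW W q))

  pairW-scale : ∀ W m (p : Poly N) → pairW W (scaleP m p) ≡ m *ℤ pairW W p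
  pairW-scale W m [] = sym (ℤP.*-zeroʳ m)
  pairW-scale W m ((k , x) ∷ p) with W x
  ... | true  rewrite pairW-scale W m p = sym (ℤP.*-distribˡ-+ m k (pairW W p))
  ... | false rewrite pairW-scale W m p =
    trans (ℤP.+-identityˡ _) (cong (m *ℤ_) (sym (ℤP.+-identityˡ _)))

  module _ {W : Subset N}
           (W-unique : ∀ x → W x ≡ true → Unique x)
           (W-balanced : ∀ pre suf {α β γ} → α F.< β → β F.< γ →
                         pairW W (sandwich pre suf (krGen α β γ)) ≡ + 0) where

    -- Generalising over the two-sided context makes the closure under lmulI and rmulI go through.
    sandwich-orthogonal : ∀ {z} → InIKR z → ∀ pre suf → pairW W (sandwich pre suf z) ≡ + 0
    sandwich-orthogonal (genKR α<β β<γ) pre suf = W-balanced pre suf α<β β<γ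
    sandwich-orthogonal (genRep x x-repeats) pre suf with W (pre ++ x ++ suf) in x∈W
    ... | false = refl
    ... | true  = ⊥-elim (x-repeats (unique-++⁻ˡ x (unique-++⁻ʳ pre (W-unique _ x∈W))))
    sandwich-orthogonal zeroI pre suf = refl
    sandwich-orthogonal (addI {p} {q} p∈I q∈I) pre suf
      rewrite sandwich-++ pre suf p q | pairW-++ W (sandwich pre suf p) (sandwich pre suf q)
            | sandwich-orthogonal p∈I pre suf | sandwich-orthogonal q∈I pre suf = refl
    sandwich-orthogonal (scaleI m {p} p∈I) pre suf
      rewrite sandwich-scale pre suf m p | pairW-scale W m (sandwich pre suf p)
            | sandwich-orthogonal p∈I pre suf = ℤP.*-zeroʳ m
    sandwich-orthogonal (lmulI u {p} p∈I) pre suf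
      rewrite sandwich-lmul pre suf u p = sandwich-orthogonal p∈I (pre ++ u) suf
    sandwich-orthogonal (rmulI u {p} p∈I) pre suf
      rewrite sandwich-rmul pre suf u p = sandwich-orthogonal p∈I pre (u ++ suf)

    orthogonal-to-ideal : InPerp W
    orthogonal-to-ideal z z∈I =
      subst (λ z → pairW W z ≡ + 0) (sandwich-identity z) (sandwich-orthogonal z∈I [] [])

module _ {N n : ℕ} {W : Subset N} where

  perp⇒admissible : InPerp W → AdmissibleOnSquares n W
  perp⇒admissible ⊥W X _ = signedCount≡0⇒admissible _
    (⊥W _ (lmulI (v X) (rmulI (w X) (genKR (a<b X) (b<c X)))))

  admissible⇒perp : W ⊆W n → AdmissibleOnSquares n W → InPerp W
  admissible⇒perp W⊆𝒲 A = orthogonal-to-ideal (λ x → proj₂ ∘ W⊆𝒲 x) balanced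
    where
    -- A square none of whose words lies in W has the empty pattern; otherwise it is a square of 𝒲ₙ.
    balanced : ∀ pre suf {α β γ} → α F.< β → β F.< γ →
               pairW W (sandwich pre suf (krGen α β γ)) ≡ + 0
    balanced pre suf {α} {β} {γ} α<β β<γ =
      admissible⇒signedCount≡0 {p = tabulate (W ∘ corner pre suf α β γ)}
        (admissible-if-marked λ j marked →
          let x∈𝒲 = W⊆𝒲 _ (trans (sym (!-tabulate (W ∘ corner pre suf α β γ) j)) marked)
              X = squareAt pre suf α<β β<γ j (proj₂ x∈𝒲)
          in A X (entry∈𝒲⇒KRof X j x∈𝒲))

  perp⇔admissible : W ⊆W n → InPerp W ⇔ AdmissibleOnSquares n W
  perp⇔admissible W⊆𝒲 = mk⇔ perp⇒admissible (admissible⇒perp W⊆𝒲)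

mainTheorem5 : (N n : ℕ) (W : Subset N) → W ⊆W n →
    (D0VertexSet n W ⇔ LocalKR n W) × (LocalKR n W ⇔ InPerp W)
mainTheorem5 N n W W⊆𝒲 =
  ⇔.trans (d0⇔admissible W⊆𝒲) (⇔.sym (local⇔admissible n W)) ,
  ⇔.trans (local⇔admissible n W) (⇔.sym (perp⇔admissible W⊆𝒲))
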